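{- For every cellular morphism $(f,s)\colon\gamma\to\delta$ between cellular automata $\gamma\colon X\to CX$ and $\delta\colon Y\to CY$, one has $f^*\circ G_\delta\circ s=G_\gamma$.
   Context: Fix a monoid $(M,\cdot,e)$, a subset $N\subseteq M$ with inclusion $i\colon N\hookrightarrow M$, and a set $S$ of states. $[A,B]$ is the set of maps $A\to B$. For $a\colon M\to X$ let $I^a\subseteq[N,S]$ be the set of $f\colon N\to S$ with $f(n)=f(n')$ whenever $a(i(n))=a(i(n'))$; for $h\colon X\to Y$, $I^{h\circ a}\subseteq I^a$. Let $CX=\coprod_{a\colon M\to X}[I^a,S]$, $(Ch)(a,f)=(h\circ a, f|_{I^{h\circ a}})$. A cellular automaton is $\gamma\colon X\to CX$, $\gamma(x)=(\gamma_1(x),\gamma_2(x))$ with $\gamma_1(x)\colon M\to X$, $\gamma_2(x)\colon I^{\gamma_1(x)}\to S$, such that $\gamma_1(x)(e)=x$ and $\gamma_1(\gamma_1(x)(m))(n)=\gamma_1(x)(n\cdot m)$. A pre-cellular morphism $h\colon\gamma\to\delta$ is a map with $Ch\circ\gamma=\delta\circ h$. Configurations $X^*=[X,S]$; $h^*(c)=c\circ h$. Global rule $G_\gamma(c)(x)=\gamma_2(x)(c\circ\gamma_1(x)\circ i)$. A cellular morphism $\gamma\to\delta$ is a pair $(f,s)$ with $f$ pre-cellular and $s\colon X^*\to Y^*$ satisfying $f^*\circ s=\mathrm{id}$. -}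

module Defs where

open import Data.Product using (Σ; _×_; _,_; proj₁; proj₂)
open import Function using (_∘_; Injective)
open import Relation.Binary.PropositionalEquality using (_≡_; cong)
open import Algebra.Structures using (IsMonoid)

-- The standing data: a monoid (M,·,e), a subset N ⊆ M given by an
-- injective inclusion i : N → M, and a set S of states.
record Frame : Set₁ where
  field
    M        : Set
    _·_      : M → M → M
    e        : M
    isMonoid : IsMonoid _≡_ _·_ e
    N        : Set
    i        : N → M
    i-inj    : Injective _≡_ _≡_ i
    S        : Set

module WithFrame (F : Frame) where
  open Frame F

  I : {X : Set} → (M → X) → Set
  I a = Σ (N → S) (λ g → ∀ n n′ → a (i n) ≡ a (i n′) → g n ≡ g n′)

  incl : {X Y : Set} (h : X → Y) (a : M → X) → I (h ∘ a) → I a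
  incl h a (g , p) = g , (λ n n′ q → p n n′ (cong h q))

  C : Set → Set
  C X = Σ (M → X) (λ a → I a → S)

  Cmap : {X Y : Set} → (X → Y) → C X → C Y
  Cmap h (a , φ) = (h ∘ a) , (λ g → φ (incl h a g))

  -- (extensional) equality of elements of CX: first components agree
  -- pointwise, second components agree on every element of the domain
  -- (membership proofs being irrelevant)
  _≈C_ : {X : Set} → C X → C X → Set
  (a , φ) ≈C (b , ψ) =
    (∀ m → a m ≡ b m) × (∀ g p q → φ (g , p) ≡ ψ (g , q))

  -- A cellular automaton γ : X → CX, γ(x) = (γ₁ x, γ₂ x).
  -- γ₂-ext records that γ₂ x is a map on the set I^{γ₁ x} of functions
  -- (extensionally equal functions are the same element of I^a).
  record CA (X : Set) : Set where
    field
      γ₁     : X → M → X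
      γ₂     : (x : X) → I (γ₁ x) → S
      γ₂-ext : ∀ x (g g′ : N → S) p p′ → (∀ n → g n ≡ g′ n) →
               γ₂ x (g , p) ≡ γ₂ x (g′ , p′)
      unit   : ∀ x → γ₁ x e ≡ x
      comp   : ∀ x m n → γ₁ (γ₁ x m) n ≡ γ₁ x (n · m)

    γ : X → C X
    γ x = γ₁ x , γ₂ x

  open CA public

  Conf : Set → Set
  Conf X = X → S

  _* : {X Y : Set} → (X → Y) → Conf Y → Conf X
  (h *) c = c ∘ h

  G : {X : Set} → CA X → Conf X → Conf X
  G γ′ c x = γ₂ γ′ x ((c ∘ γ₁ γ′ x ∘ i) , (λ n n′ q → cong c q))

  PreCellular : {X Y : Set} → CA X → CA Y → (X → Y) → Set
  PreCellular {X} γ′ δ h = ∀ (x : X) → Cmap h (γ γ′ x) ≈C γ δ (h x)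

  record Cellular {X Y : Set} (γ′ : CA X) (δ : CA Y) : Set where
    field
      f          : X → Y
      s          : Conf X → Conf Y
      f-pre      : PreCellular γ′ δ f
      section    : ∀ (c : Conf X) (x : X) → (f *) (s c) x ≡ c x

{-# OPTIONS --safe #-}
-- A pre-cellular map f intertwines the global rules, f* ∘ G_δ = G_γ ∘ f*:
-- δ at f x sees the neighbourhood f ∘ γ₁ x and applies the restriction of
-- γ₂ x to it. Precomposing with s and using f* ∘ s = id gives the theorem.
module Submission where

open import Defs
open import Data.Product using (_,_; proj₁; proj₂)
open import Function using (_∘_)
open import Relation.Binary.PropositionalEquality
  using (_≡_; refl; cong; sym; trans; module ≡-Reasoning)

module _ (F : Frame) where
  open Frame F
  open WithFrame F

  G-cong : {X : Set} (γ : CA X) {c c′ : Conf X} → (∀ x → c x ≡ c′ x) →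
           ∀ x → G γ c x ≡ G γ c′ x
  G-cong γ c≗c′ x = γ₂-ext γ x _ _ _ _ (λ n → c≗c′ (γ₁ γ x (i n)))

  G-natural : {X Y : Set} (γ : CA X) (δ : CA Y) {h : X → Y} →
              PreCellular γ δ h →
              ∀ (d : Conf Y) x → (h *) (G δ d) x ≡ G γ ((h *) d) x
  G-natural γ δ {h} h-pre d x = begin
    G δ d (h x)                         ≡⟨ γ₂-ext δ (h x) _ _ _ q (λ n → cong d (sym (nbhd (i n)))) ⟩
    γ₂ δ (h x) (g , q)                  ≡⟨ sym (proj₂ (h-pre x) g p q) ⟩
    γ₂ γ x (incl h (γ₁ γ x) (g , p))    ≡⟨ γ₂-ext γ x _ _ _ _ (λ _ → refl) ⟩
    G γ ((h *) d) x                     ∎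
    where
    open ≡-Reasoning

    nbhd : ∀ m → h (γ₁ γ x m) ≡ γ₁ δ (h x) m
    nbhd = proj₁ (h-pre x)

    g : N → S
    g = d ∘ h ∘ γ₁ γ x ∘ i

    p : ∀ n n′ → h (γ₁ γ x (i n)) ≡ h (γ₁ γ x (i n′)) → g n ≡ g n′
    p n n′ = cong d

    q : ∀ n n′ → γ₁ δ (h x) (i n) ≡ γ₁ δ (h x) (i n′) → g n ≡ g n′
    q n n′ r = cong d (trans (nbhd (i n)) (trans r (sym (nbhd (i n′)))))

lemma5 : (F : Frame) → let open WithFrame F in
    {X Y : Set} (γ : CA X) (δ : CA Y) (φ : Cellular γ δ) →
      let open Cellular φ in
      ∀ (c : Conf X) (x : X) → (f *) (G δ (s c)) x ≡ G γ c x
lemma5 F γ δ φ c x =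
  trans (G-natural F γ δ f-pre (s c) x) (G-cong F γ (section c) x)
  where open WithFrame.Cellular φ
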